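{- Let $(X,\tau\circ\gamma,\mathcal{F})$ be an $\mathbb{F}$-augmented generalized closure space and $\mathcal{R}(X)$ the set of its $\mathbb{F}$-regular open sets. Then $(\mathcal{R}(X),\subseteq)$ is a dcpo.
   Context: A closure operator on $X$ is a map $\gamma:\mathcal{P}(X)\to\mathcal{P}(X)$ that is extensive, idempotent and monotone. A generalized closure space is a pair $(X,\tau\circ\gamma)$ where $\gamma$ is a closure operator and $\tau:\mathcal{P}(X)\to\mathcal{P}(X)$ satisfies for all $A,B\subseteq X$: $\tau(\gamma(A))\subseteq\gamma(A)$; $\tau(\tau(\gamma(A)))=\tau(\gamma(A))$; $A\subseteq B\Rightarrow\tau(\gamma(A))\subseteq\tau(\gamma(B))$. Write $\langle A\rangle=\tau(\gamma(A))$. An $\mathbb{F}$-augmented generalized closure space is a triple $(X,\tau\circ\gamma,\mathcal{F})$ with $(X,\tau\circ\gamma)$ a generalized closure space and $\mathcal{F}$ a nonempty family of finite subsets of $X$ such that for every $F\in\mathcal{F}$ and finite $M\subseteq\langle F\rangle$ there is $F_1\in\mathcal{F}$ with $M\subseteq\langle F_1\rangle$ and $F_1\subseteq\langle F\rangle$. An $\mathbb{F}$-regular open set is a nonempty $U\subseteq X$ such that for every finite $M\subseteq U$ (including $M=\emptyset$) there is $F\in\mathcal{F}$ with $M\subseteq\langle F\rangle\subseteq U$. A dcpo is a poset in which every directed subset has a supremum. -}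

module Defs where

open import Level using (Level; suc; _⊔_)
open import Data.Product using (Σ; ∃; ∃-syntax; _×_; _,_)
open import Data.List using (List)
open import Data.List.Membership.Propositional using (_∈_)
open import Relation.Unary using (Pred; _⊆_; _≐_)

-- a finite subset M ⊆ U, M given by a list enumerating it
_⊆ₗ_ : ∀ {ℓ} {X : Set ℓ} → List X → Pred X ℓ → Set ℓ
M ⊆ₗ U = ∀ {x} → x ∈ M → U x

⟦_⟧ : ∀ {ℓ} {X : Set ℓ} → List X → Pred X ℓ
⟦ M ⟧ x = x ∈ M

record IsClosureOperator {ℓ} {X : Set ℓ} (γ : Pred X ℓ → Pred X ℓ) : Set (suc ℓ) where
  field
    extensive  : ∀ A → A ⊆ γ A
    idempotent : ∀ A → γ (γ A) ≐ γ A
    monotone   : ∀ {A B} → A ⊆ B → γ A ⊆ γ B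

record IsGenClosureSpace {ℓ} {X : Set ℓ} (τ γ : Pred X ℓ → Pred X ℓ) : Set (suc ℓ) where
  field
    γ-closure : IsClosureOperator γ
    τ-shrink  : ∀ A → τ (γ A) ⊆ γ A
    τ-idem    : ∀ A → τ (τ (γ A)) ≐ τ (γ A)
    τγ-mono   : ∀ {A B} → A ⊆ B → τ (γ A) ⊆ τ (γ B)

⟨_⟩[_,_] : ∀ {ℓ} {X : Set ℓ} → Pred X ℓ → (τ γ : Pred X ℓ → Pred X ℓ) → Pred X ℓ
⟨ A ⟩[ τ , γ ] = τ (γ A)

-- The family 𝓕 of finite subsets is given as a predicate on lists
-- (a finite subset belongs to 𝓕 iff some/any list enumerating it is accepted).
record IsFAugmented {ℓ} {X : Set ℓ} (τ γ : Pred X ℓ → Pred X ℓ)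
                    (𝓕 : Pred (List X) ℓ) : Set (suc ℓ) where
  field
    genClosure : IsGenClosureSpace τ γ
    nonempty   : ∃[ F ] 𝓕 F
    augmented  : ∀ F → 𝓕 F → ∀ (M : List X) → M ⊆ₗ ⟨ ⟦ F ⟧ ⟩[ τ , γ ] →
                 ∃[ F₁ ] (𝓕 F₁ × M ⊆ₗ ⟨ ⟦ F₁ ⟧ ⟩[ τ , γ ] × F₁ ⊆ₗ ⟨ ⟦ F ⟧ ⟩[ τ , γ ])

record IsFRegularOpen {ℓ} {X : Set ℓ} (τ γ : Pred X ℓ → Pred X ℓ)
                      (𝓕 : Pred (List X) ℓ) (U : Pred X ℓ) : Set (suc ℓ) where
  field
    inhabited : ∃[ x ] U x
    regular   : ∀ (M : List X) → M ⊆ₗ U →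
                ∃[ F ] (𝓕 F × M ⊆ₗ ⟨ ⟦ F ⟧ ⟩[ τ , γ ] × ⟨ ⟦ F ⟧ ⟩[ τ , γ ] ⊆ U)

record IsDirected {ℓ} {X : Set ℓ} {I : Set ℓ} (D : I → Pred X ℓ) : Set ℓ where
  field
    inhabitedIdx : I
    upperBound   : ∀ i j → ∃[ k ] (D i ⊆ D k × D j ⊆ D k)

record IsSupremumIn {ℓ} {X : Set ℓ} (P : Pred X ℓ → Set (suc ℓ)) {I : Set ℓ}
                    (D : I → Pred X ℓ) (S : Pred X ℓ) : Set (suc ℓ) where
  field
    inP   : P S
    upper : ∀ i → D i ⊆ S
    least : ∀ (T : Pred X ℓ) → P T → (∀ i → D i ⊆ T) → S ⊆ T

IsDCPO : ∀ {ℓ} {X : Set ℓ} (P : Pred X ℓ → Set (suc ℓ)) → Set (suc ℓ)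
IsDCPO {ℓ} {X} P = ∀ (I : Set ℓ) (D : I → Pred X ℓ) → (∀ i → P (D i)) → IsDirected D →
                   ∃[ S ] IsSupremumIn P D S

module Submission where

-- The supremum of a directed family of 𝔽-regular open sets is its union.
--
-- The argument rests on one general fact about directed families of
-- subsets: every finite subset of the union of a directed family lies in a
-- single member of the family (induction on the list enumerating it, using
-- an upper bound of two members at each step; the empty list lands in the
-- member indexed by the family's inhabitant).  Consequently the union of a
-- directed family of 𝔽-regular open sets is again 𝔽-regular open: a finite
-- M ⊆ ⋃ D lies in some D k, and the 𝔽-witness that D k provides for M also
-- works for the larger set ⋃ D.  The union is trivially the least upper
-- bound of the family among all subsets, hence among the 𝔽-regular open
-- ones.

open import Defs
open import Data.List using (List; []; _∷_)
open import Data.List.Relation.Unary.Any using (here; there)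
open import Data.Product using (Σ; ∃-syntax; _×_; _,_)
open import Relation.Binary.PropositionalEquality using (refl)
open import Relation.Unary using (Pred; _⊆_)

⋃ : ∀ {ℓ} {X : Set ℓ} {I : Set ℓ} → (I → Pred X ℓ) → Pred X ℓ
⋃ {I = I} D x = Σ I (λ i → D i x)

module _ {ℓ} {X : Set ℓ} {I : Set ℓ} (D : I → Pred X ℓ) where

  ⋃-upper : ∀ i → D i ⊆ ⋃ D
  ⋃-upper i d = i , d

  ⋃-least : ∀ (T : Pred X ℓ) → (∀ i → D i ⊆ T) → ⋃ D ⊆ T
  ⋃-least T up (i , d) = up i d

  finite⊆⋃⇒⊆member : IsDirected D → ∀ (M : List X) → M ⊆ₗ ⋃ D → ∃[ k ] (M ⊆ₗ D k)
  finite⊆⋃⇒⊆member dir [] _ = IsDirected.inhabitedIdx dir , λ ()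
  finite⊆⋃⇒⊆member dir (x ∷ M) x∷M⊆⋃
    with x∷M⊆⋃ (here refl) | finite⊆⋃⇒⊆member dir M (λ p → x∷M⊆⋃ (there p))
  ... | i , x∈Di | k , M⊆Dk with IsDirected.upperBound dir i k
  ... | m , Di⊆Dm , Dk⊆Dm = m , λ { (here refl) → Di⊆Dm x∈Di
                                  ; (there p)   → Dk⊆Dm (M⊆Dk p) }

module _ {ℓ} {X : Set ℓ} (τ γ : Pred X ℓ → Pred X ℓ) (𝓕 : Pred (List X) ℓ) where

  ⋃-regularOpen : {I : Set ℓ} (D : I → Pred X ℓ) → (∀ i → IsFRegularOpen τ γ 𝓕 (D i)) →
                  IsDirected D → IsFRegularOpen τ γ 𝓕 (⋃ D)
  ⋃-regularOpen {I} D regD dir = record { inhabited = inhabited ; regular = regular }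
    where
    i₀ : I
    i₀ = IsDirected.inhabitedIdx dir

    inhabited : ∃[ x ] ⋃ D x
    inhabited with IsFRegularOpen.inhabited (regD i₀)
    ... | x , x∈Di₀ = x , i₀ , x∈Di₀

    regular : ∀ (M : List X) → M ⊆ₗ ⋃ D →
              ∃[ F ] (𝓕 F × M ⊆ₗ ⟨ ⟦ F ⟧ ⟩[ τ , γ ] × ⟨ ⟦ F ⟧ ⟩[ τ , γ ] ⊆ ⋃ D)
    regular M M⊆⋃ with finite⊆⋃⇒⊆member D dir M M⊆⋃
    ... | k , M⊆Dk with IsFRegularOpen.regular (regD k) M M⊆Dk
    ... | F , F∈𝓕 , M⊆⟨F⟩ , ⟨F⟩⊆Dk = F , F∈𝓕 , M⊆⟨F⟩ , λ p → ⋃-upper D k (⟨F⟩⊆Dk p)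

proposition3p13 : ∀ {ℓ} {X : Set ℓ} (τ γ : Pred X ℓ → Pred X ℓ) (𝓕 : Pred (List X) ℓ) →
                  IsFAugmented τ γ 𝓕 → IsDCPO (IsFRegularOpen τ γ 𝓕)
proposition3p13 τ γ 𝓕 _ I D regD dir = ⋃ D , record
  { inP   = ⋃-regularOpen τ γ 𝓕 D regD dir
  ; upper = ⋃-upper D
  ; least = λ T _ → ⋃-least D T
  }
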